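{- Let $G$ be a graph or digraph. Every dapasting of a pair of dacards of $G$ as members of $\mathrm{Dadeck}(G)$ has a unique completion up to isomorphism.
   Context: Digraphs are finite, without loops or multiple arcs; a graph is regarded as a digraph in which every edge is a pair of opposite arcs. For a vertex $x$ of a digraph $D$, $\mathrm{dt}_D(x)=(a,b,c)$ where $a,b,c$ count vertices $w$ such that respectively only $xw$, only $wx$, both $xw,wx$ are arcs. A dacard of $D$ is a pair $(D-x,\mathrm{dt}_D(x))$, with $D-x$ up to isomorphism; $\mathrm{Dadeck}(D)$ is the multiset of dacards; digraphs with the same dadeck are da-hypomorphs. A dapasting of dacards $(A,\alpha),(B,\beta)$ of $G$ (obtained by deleting distinct vertices) as members of $\mathrm{Dadeck}(G)$ is a digraph $P$ with two distinct non-adjacent vertices $u,v$, labeled $(e,\alpha)$ and $(e,\beta)$ respectively, such that $P-u\cong A$, $P-v\cong B$ and there is $Y\in\{P,P+uv,P+vu,P+uv+vu\}$ ($P+xy$ = $P$ with arc $xy$ added) with $\mathrm{dt}_Y(u)=\alpha$, $\mathrm{dt}_Y(v)=\beta$ and $Y$ da-hypomorphic to $G$; every digraph isomorphic to such a $Y$ is called a completion of $P$. -}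

module Defs where

open import Data.Nat using (ℕ; zero; suc; _+_)
open import Data.Bool using (Bool; true; false; _∧_; _∨_; not; if_then_else_)
open import Data.Fin using (Fin; zero; suc; punchIn; _≟_)
open import Data.Product using (Σ; _×_; _,_; ∃-syntax)
open import Function.Bundles using (_↔_; Inverse)
open import Relation.Binary.PropositionalEquality using (_≡_; refl; trans; sym)
open import Relation.Nullary using (¬_; yes; no; does)
open import Data.Empty using (⊥-elim)

-- A digraph on the vertex set Fin n: a Boolean arc relation without loops.
-- (No multiple arcs by construction.) A graph is a digraph with symmetric arcs.
record Digraph (n : ℕ) : Set where
  field
    arc      : Fin n → Fin n → Bool
    loopless : ∀ x → arc x x ≡ false
open Digraph public

count : ∀ {n} → (Fin n → Bool) → ℕ
count {zero}  p = 0
count {suc n} p = (if p zero then 1 else 0) + count (λ i → p (suc i))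

dt : ∀ {n} → Digraph n → Fin n → ℕ × ℕ × ℕ
dt D x =
  ( count (λ w → arc D x w ∧ not (arc D w x))
  , count (λ w → not (arc D x w) ∧ arc D w x)
  , count (λ w → arc D x w ∧ arc D w x) )

_─_ : ∀ {n} → Digraph (suc n) → Fin (suc n) → Digraph n
D ─ x = record
  { arc      = λ i j → arc D (punchIn x i) (punchIn x j)
  ; loopless = λ i → loopless D (punchIn x i) }

Iso : ∀ {n} → Digraph n → Digraph n → Set
Iso {n} D E = Σ (Fin n ↔ Fin n) λ σ →
  ∀ i j → arc E (Inverse.to σ i) (Inverse.to σ j) ≡ arc D i j

-- Dadeck(D) = Dadeck(H) as multisets of dacards (D - x , dt_D(x)), with the
-- card component taken up to isomorphism: a bijection between the vertex
-- sets matching the dacards.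
DaHypomorphic : ∀ {n} → Digraph (suc n) → Digraph (suc n) → Set
DaHypomorphic {n} D H = Σ (Fin (suc n) ↔ Fin (suc n)) λ σ →
  ∀ x → Iso (D ─ x) (H ─ Inverse.to σ x) × (dt D x ≡ dt H (Inverse.to σ x))

private
  notBoth : ∀ {n} (u v : Fin n) → ¬ u ≡ v → ∀ x → (does (x ≟ u) ∧ does (x ≟ v)) ≡ false
  notBoth u v u≢v x with x ≟ u | x ≟ v
  ... | yes refl | yes refl = ⊥-elim (u≢v refl)
  ... | yes _    | no _     = refl
  ... | no _     | _        = refl

  ∧false : ∀ b → (b ∧ false) ≡ false
  ∧false true  = refl
  ∧false false = refl

addArcs : ∀ {n} → Digraph n → (u v : Fin n) → ¬ u ≡ v → Bool → Bool → Digraph n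
addArcs P u v u≢v b₁ b₂ = record
  { arc = λ i j → arc P i j
                  ∨ (b₁ ∧ (does (i ≟ u) ∧ does (j ≟ v)))
                  ∨ (b₂ ∧ (does (i ≟ v) ∧ does (j ≟ u)))
  ; loopless = lp }
  where
  lp : ∀ x → (arc P x x ∨ (b₁ ∧ (does (x ≟ u) ∧ does (x ≟ v)))
                        ∨ (b₂ ∧ (does (x ≟ v) ∧ does (x ≟ u)))) ≡ false
  lp x rewrite loopless P x
             | notBoth u v u≢v x
             | notBoth v u (λ e → u≢v (sym e)) x
             | ∧false b₁ | ∧false b₂ = refl

Admissible : ∀ {n} (G : Digraph (suc n)) (x y : Fin (suc n))
             (P : Digraph (suc n)) (u v : Fin (suc n)) (u≢v : ¬ u ≡ v) →
             Bool → Bool → Set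
Admissible G x y P u v u≢v b₁ b₂ =
  let Y = addArcs P u v u≢v b₁ b₂ in
  (dt Y u ≡ dt G x) × (dt Y v ≡ dt G y) × DaHypomorphic Y G

-- P (with distinct vertices u, v labelled by α = dt_G x, β = dt_G y) is a
-- dapasting of the dacards (G - x, dt_G x), (G - y, dt_G y), x ≠ y.
IsDapasting : ∀ {n} (G : Digraph (suc n)) (x y : Fin (suc n))
              (P : Digraph (suc n)) (u v : Fin (suc n)) (u≢v : ¬ u ≡ v) → Set
IsDapasting G x y P u v u≢v =
  (¬ x ≡ y) ×
  (arc P u v ≡ false) × (arc P v u ≡ false) ×
  Iso (P ─ u) (G ─ x) × Iso (P ─ v) (G ─ y) ×
  (∃[ b₁ ] ∃[ b₂ ] Admissible G x y P u v u≢v b₁ b₂)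

IsCompletion : ∀ {n} (G : Digraph (suc n)) (x y : Fin (suc n))
               (P : Digraph (suc n)) (u v : Fin (suc n)) (u≢v : ¬ u ≡ v) →
               Digraph (suc n) → Set
IsCompletion G x y P u v u≢v Z =
  ∃[ b₁ ] ∃[ b₂ ] (Admissible G x y P u v u≢v b₁ b₂ × Iso Z (addArcs P u v u≢v b₁ b₂))

{-# OPTIONS --safe #-}
-- Adding arcs between the non-adjacent vertices u and v changes the degree
-- triple of u only through the pair {u, v}: dt_Y(u) = dt_P(u) + t, where t is
-- the unit vector of the type (out, in, both) of the added arcs, or 0 if none
-- is added.  So the condition dt_Y(u) = α already fixes which of P, P+uv, P+vu,
-- P+uv+vu is Y, and all completions are isomorphic to that single Y.
module Submission where

open import Defs
open import Data.Nat using (ℕ; zero; suc; _+_; _<ᵇ_)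
open import Data.Nat.Properties using (+-comm; +-assoc; +-cancelˡ-≡)
open import Data.Bool using (Bool; true; false; _∧_; _∨_; not; if_then_else_)
open import Data.Bool.Properties using (∧-zeroʳ; ∧-identityʳ; ∨-identityʳ)
open import Data.Fin using (Fin; zero; suc; _≟_)
open import Data.Fin.Properties using (suc-injective)
open import Data.Product using (Σ; _×_; _,_; proj₁; proj₂)
open import Function using (_∘_)
open import Function.Bundles using (Inverse)
open import Function.Properties.Inverse using (↔-refl; ↔-sym)
open import Relation.Binary.PropositionalEquality
open import Relation.Nullary using (¬_; yes; no; does)
open import Data.Empty using (⊥-elim)

ind : Bool → ℕ
ind b = if b then 1 else 0

count-cong : ∀ {m} {p q : Fin m → Bool} → (∀ w → p w ≡ q w) → count p ≡ count q
count-cong {zero}  e = refl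
count-cong {suc m} e = cong₂ _+_ (cong ind (e zero)) (count-cong (e ∘ suc))

count-except : ∀ {m} (p q : Fin m → Bool) (v : Fin m) →
               (∀ w → ¬ w ≡ v → p w ≡ q w) → q v ≡ false →
               count p ≡ count q + ind (p v)
count-except {suc m} p q zero agree qv rewrite qv =
  trans (+-comm (ind (p zero)) _)
        (cong (_+ ind (p zero)) (count-cong (λ w → agree (suc w) λ ())))
count-except {suc m} p q (suc v) agree qv rewrite agree zero (λ ()) =
  trans (cong (ind (q zero) +_) (count-except (p ∘ suc) (q ∘ suc) v
                                   (λ w w≢v → agree (suc w) (w≢v ∘ suc-injective)) qv))
        (sym (+-assoc (ind (q zero)) _ _))

_⊕_ : ℕ × ℕ × ℕ → ℕ × ℕ × ℕ → ℕ × ℕ × ℕ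
(a , b , c) ⊕ (a′ , b′ , c′) = (a + a′ , b + b′ , c + c′)

⊕-cancelˡ : ∀ t {s s′} → t ⊕ s ≡ t ⊕ s′ → s ≡ s′
⊕-cancelˡ (a , b , c) e =
  cong₂ _,_ (+-cancelˡ-≡ a _ _ (cong proj₁ e))
            (cong₂ _,_ (+-cancelˡ-≡ b _ _ (cong (proj₁ ∘ proj₂) e))
                       (+-cancelˡ-≡ c _ _ (cong (proj₂ ∘ proj₂) e)))

arcType : Bool → Bool → ℕ × ℕ × ℕ
arcType b₁ b₂ = (ind (b₁ ∧ not b₂) , ind (not b₁ ∧ b₂) , ind (b₁ ∧ b₂))

arcType-injective : ∀ {b₁ b₂ b₁′ b₂′} → arcType b₁ b₂ ≡ arcType b₁′ b₂′ →
                    (b₁ , b₂) ≡ (b₁′ , b₂′)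
arcType-injective {b₁} {b₂} {b₁′} {b₂′} e =
  trans (sym (decode-arcType b₁ b₂)) (trans (cong decode e) (decode-arcType b₁′ b₂′))
  where
  decode : ℕ × ℕ × ℕ → Bool × Bool
  decode (a , b , c) = ((0 <ᵇ a + c) , (0 <ᵇ b + c))

  decode-arcType : ∀ b₁ b₂ → decode (arcType b₁ b₂) ≡ (b₁ , b₂)
  decode-arcType false false = refl
  decode-arcType false true  = refl
  decode-arcType true  false = refl
  decode-arcType true  true  = refl

module _ {n} (P : Digraph (suc n)) (u v : Fin (suc n)) (u≢v : ¬ u ≡ v) where

  arc-addArcs-from : ∀ b₁ b₂ w →
    arc (addArcs P u v u≢v b₁ b₂) u w ≡ arc P u w ∨ (b₁ ∧ does (w ≟ v))
  arc-addArcs-from b₁ b₂ w with u ≟ u | u ≟ v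
  ... | no u≢u | _       = ⊥-elim (u≢u refl)
  ... | yes _  | yes u≡v = ⊥-elim (u≢v u≡v)
  ... | yes _  | no _    rewrite ∧-zeroʳ b₂ | ∨-identityʳ (b₁ ∧ does (w ≟ v)) = refl

  arc-addArcs-to : ∀ b₁ b₂ w →
    arc (addArcs P u v u≢v b₁ b₂) w u ≡ arc P w u ∨ (b₂ ∧ does (w ≟ v))
  arc-addArcs-to b₁ b₂ w with u ≟ u | u ≟ v
  ... | no u≢u | _       = ⊥-elim (u≢u refl)
  ... | yes _  | yes u≡v = ⊥-elim (u≢v u≡v)
  ... | yes _  | no _
    rewrite ∧-zeroʳ (does (w ≟ u)) | ∧-zeroʳ b₁ | ∧-identityʳ (does (w ≟ v)) = refl

  module _ (puv : arc P u v ≡ false) (pvu : arc P v u ≡ false) (b₁ b₂ : Bool) where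

    private
      Y : Digraph (suc n)
      Y = addArcs P u v u≢v b₁ b₂

    added-arc : ∀ {a} b → a ≡ false → (a ∨ (b ∧ does (v ≟ v))) ≡ b
    added-arc b refl with v ≟ v
    ... | yes _   = ∧-identityʳ b
    ... | no v≢v = ⊥-elim (v≢v refl)

    count-addArcs : (h : Bool → Bool → Bool) → h false false ≡ false →
      count (λ w → h (arc Y u w) (arc Y w u)) ≡
      count (λ w → h (arc P u w) (arc P w u)) + ind (h b₁ b₂)
    count-addArcs h hff =
      trans (count-except _ _ v unchanged-off-v unchanged-at-v)
            (cong ((count (λ w → h (arc P u w) (arc P w u)) +_) ∘ ind)
                  (cong₂ h (trans (arc-addArcs-from b₁ b₂ v) (added-arc b₁ puv))
                           (trans (arc-addArcs-to b₁ b₂ v) (added-arc b₂ pvu))))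
      where
      unchanged-off-v : ∀ w → ¬ w ≡ v →
        h (arc Y u w) (arc Y w u) ≡ h (arc P u w) (arc P w u)
      unchanged-off-v w w≢v rewrite arc-addArcs-from b₁ b₂ w | arc-addArcs-to b₁ b₂ w
        with w ≟ v
      ... | yes w≡v = ⊥-elim (w≢v w≡v)
      ... | no _ rewrite ∧-zeroʳ b₁ | ∧-zeroʳ b₂
                       | ∨-identityʳ (arc P u w) | ∨-identityʳ (arc P w u) = refl

      unchanged-at-v : h (arc P u v) (arc P v u) ≡ false
      unchanged-at-v rewrite puv | pvu = hff

    dt-addArcs : dt Y u ≡ dt P u ⊕ arcType b₁ b₂
    dt-addArcs =
      cong₂ _,_ (count-addArcs (λ a b → a ∧ not b) refl)
                (cong₂ _,_ (count-addArcs (λ a b → not a ∧ b) refl)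
                           (count-addArcs _∧_ refl))

  addArcs-determined-by-dt : arc P u v ≡ false → arc P v u ≡ false →
    ∀ b₁ b₂ b₁′ b₂′ →
    dt (addArcs P u v u≢v b₁ b₂) u ≡ dt (addArcs P u v u≢v b₁′ b₂′) u →
    (b₁ , b₂) ≡ (b₁′ , b₂′)
  addArcs-determined-by-dt puv pvu b₁ b₂ b₁′ b₂′ e =
    arcType-injective (⊕-cancelˡ (dt P u)
      (trans (sym (dt-addArcs puv pvu b₁ b₂)) (trans e (dt-addArcs puv pvu b₁′ b₂′))))

Iso-refl : ∀ {n} (D : Digraph n) → Iso D D
Iso-refl D = ↔-refl , λ _ _ → refl

Iso-sym : ∀ {n} {D E : Digraph n} → Iso D E → Iso E D
Iso-sym {E = E} (σ , σ-preserves) = ↔-sym σ , λ i j →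
  trans (sym (σ-preserves (Inverse.from σ i) (Inverse.from σ j)))
        (cong₂ (arc E) (Inverse.strictlyInverseˡ σ i) (Inverse.strictlyInverseˡ σ j))

corollary5p3 : ∀ {n} (G : Digraph (suc n)) (x y : Fin (suc n))
               (P : Digraph (suc n)) (u v : Fin (suc n)) (u≢v : ¬ u ≡ v) →
               IsDapasting G x y P u v u≢v →
               Σ (Digraph (suc n)) λ Z →
                 IsCompletion G x y P u v u≢v Z ×
                 (∀ Z′ → IsCompletion G x y P u v u≢v Z′ → Iso Z Z′)
corollary5p3 {n} G x y P u v u≢v (_ , puv , pvu , _ , _ , b₁ , b₂ , admissible) =
  Y , (b₁ , b₂ , admissible , Iso-refl Y) , unique
  where
  Y : Digraph (suc n)
  Y = addArcs P u v u≢v b₁ b₂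

  unique : ∀ Z′ → IsCompletion G x y P u v u≢v Z′ → Iso Y Z′
  unique Z′ (b₁′ , b₂′ , admissible′ , Z′≅Y′)
    with addArcs-determined-by-dt P u v u≢v puv pvu b₁ b₂ b₁′ b₂′
           (trans (proj₁ admissible) (sym (proj₁ admissible′)))
  ... | refl = Iso-sym {D = Z′} {E = Y} Z′≅Y′
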